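{- Let $\varGamma$ be a planar lattice equipped with a positive definite, integer-valued, primitive symmetric bilinear form $(\cdot,\cdot)$, let $d$ be its discriminant and $\varGamma^*$ its dual lattice. For a primitive vector $w\in\varGamma$, let $\varGamma_w$ be the sublattice spanned by $w$ and the primitive vector $z\in\varGamma$ orthogonal to $w$. Let $w,w'$ be primitive vectors of $\varGamma$ such that $w \equiv w' \pmod{d\varGamma^*}$ and $w \equiv w' \pmod{2 \varGamma}$. Then $[\varGamma : \varGamma_w ] \equiv [\varGamma : \varGamma_{w'} ] \pmod{2}$.
   Context: Primitivity of the form means $\gcd(a,b,c)=1$ for the Gram matrix $\left(\begin{smallmatrix} a & b \\ b & c\end{smallmatrix}\right)$ with respect to any basis of $\varGamma$; the discriminant $d=ac-b^2$ is the determinant of any Gram matrix. The dual lattice is $\varGamma^* = \{u \in \mathbb{Q}\varGamma \mid (v,u)\in\mathbb{Z} \text{ for all } v\in\varGamma\}\supseteq\varGamma$. The primitive vector $z\perp w$ in $\varGamma$ is unique up to sign, so $\varGamma_w=\mathbb{Z}w\oplus\mathbb{Z}z$ is well defined. (By a previous result, $[\varGamma:\varGamma_w]=(w,w)/g^*(w)$ where $g^*(w)$ is the coefficient of $w$ in $\varGamma^*$, i.e. the positive rational $g$ with $w=g w_0$, $w_0$ primitive in $\varGamma^*$; and $g^*(w)=g^*(w')$ when $w\equiv w' \pmod{d\varGamma^*}$.) -}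

module Defs where

open import Data.Integer using (ℤ; +_; _+_; _-_; _*_; -_; ∣_∣; _<_; 0ℤ; 1ℤ)
open import Data.Integer.GCD using (gcd)
open import Data.Integer.Divisibility using (_∣_)
open import Data.Product using (_×_; _,_)
open import Relation.Binary.PropositionalEquality using (_≡_)
import Data.Nat as ℕ

-- The planar lattice Γ is identified with ℤ² via a basis; vectors are
-- coordinate pairs.
Vec2 : Set
Vec2 = ℤ × ℤ

_⊖_ : Vec2 → Vec2 → Vec2
(x , y) ⊖ (x' , y') = (x - x') , (y - y')

_·_ : ℤ → Vec2 → Vec2
k · (x , y) = (k * x) , (k * y)

-- Symmetric bilinear form given by its Gram matrix ( a b ; b c ).
record Form : Set where
  constructor form
  field
    a b c : ℤ

open Form public

B : Form → Vec2 → Vec2 → ℤ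
B G (x , y) (x' , y') = a G * x * x' + b G * (x * y' + y * x') + c G * y * y'

disc : Form → ℤ
disc G = a G * c G - b G * b G

-- Positive definite (for a binary form: a > 0 and ac - b² > 0).
PosDef : Form → Set
PosDef G = (0ℤ < a G) × (0ℤ < disc G)

PrimitiveForm : Form → Set
PrimitiveForm G = gcd (gcd (a G) (b G)) (c G) ≡ 1ℤ

PrimitiveVec : Vec2 → Set
PrimitiveVec (x , y) = gcd x y ≡ 1ℤ

Orth : Form → Vec2 → Vec2 → Set
Orth G v u = B G v u ≡ 0ℤ

-- Membership in Γ*: u ∈ ℚΓ with (v,u) ∈ ℤ for all v ∈ Γ.
-- Hence  w - w' ∈ dΓ*  iff  (w - w')/d ∈ Γ*  iff  d ∣ (v , w - w') for all v ∈ Γ.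
CongModDDual : Form → Vec2 → Vec2 → Set
CongModDDual G w w' = ∀ (v : Vec2) → disc G ∣ B G v (w ⊖ w')

CongMod2Γ : Vec2 → Vec2 → Set
CongMod2Γ w w' = Data.Product.∃ λ (u : Vec2) → w ⊖ w' ≡ (+ 2) · u

-- Index [Γ : ℤw ⊕ ℤz] of the sublattice spanned by w and z
-- (= |det(w, z)| in coordinates of a basis of Γ).
index : Vec2 → Vec2 → ℕ.ℕ
index (x , y) (z₁ , z₂) = ∣ x * z₂ - y * z₁ ∣

-- Write Gw for the coordinates of w in the basis of Γ* dual to the basis of Γ.  As
-- (w, z) = Gw · z = 0 with z = (s, t) primitive, Gw = l (t, -s) for an integer l with
-- |l| = g*(w), and then (w, w) = w · Gw = l det(w, z) = ± l [Γ : Γ_w].  Cramer's rule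
-- d w = adj(G) Gw with w primitive gives l ∣ d; hence d ∣ Gw - Gw' transfers l ∣ Gw to
-- l ∣ Gw' = l' (t', -s'), so l ∣ l', and symmetrically |l| = |l'|.  Finally
-- (w, w) - (w', w') = (w - w') · (Gw + Gw') lies in 2lℤ because w - w' ∈ 2Γ, and
-- dividing by l ≠ 0 gives det(w, z) ≡ ± det(w', z') (mod 2).
module Submission where

open import Defs
open import Data.Nat using (_%_)
open import Relation.Binary.PropositionalEquality using (_≡_)

open import Data.Integer
  using (ℤ; +_; -[1+_]; _+_; _-_; _*_; -_; ∣_∣; 0ℤ; 1ℤ; -1ℤ; ≢-nonZero)
open import Data.Integer.Divisibility.Signed
  using ( _∣_; ∣ᵤ⇒∣; ∣⇒∣ᵤ; ∣-refl; ∣-trans; 0∣⇒≡0; ∣m∣n⇒∣m+n; ∣m∣n⇒∣m-n; ∣m⇒∣-m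
        ; ∣n⇒∣m*n; ∣m⇒∣m*n; *-monoʳ-∣; *-cancelˡ-∣)
open import Data.Integer.Properties
  using ( +-injective; pos-*; -1*i≡-i; *-identityˡ; *-identityʳ; *-comm; *-assoc; +-comm
        ; ∣-i∣≡∣i∣; <-irrefl)
open import Data.Integer.GCD using (gcd; gcd-comm)
open import Data.Integer.Tactic.RingSolver using (solve-∀)
import Data.Nat as ℕ
import Data.Nat.Coprimality as ℕ using (coprime-Bézout; gcd≡1⇒coprime)
import Data.Nat.DivMod as ℕ using (m%n<n)
import Data.Nat.Divisibility as ℕ using (_∣_; _∣?_; ∣-antisym; m%n≡0⇒n∣m; n∣m⇒m%n≡0)
import Data.Nat.GCD as ℕ using (gcd; module Bézout)
open import Data.Product using (∃; ∃₂; _×_; _,_)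
open import Data.Sum using (_⊎_; inj₁; inj₂)
open import Function using (_∘_)
open import Relation.Binary.PropositionalEquality
  using (_≢_; refl; sym; trans; cong; cong₂; subst; module ≡-Reasoning)
open import Relation.Nullary using (¬_; yes; no; contradiction)

infix 7 _∙_
infix 4 _∣ᵥ_

_∙_ : Vec2 → Vec2 → ℤ
(x , y) ∙ (x' , y') = x * x' + y * y'

det : Vec2 → Vec2 → ℤ
det (x , y) (s , t) = x * t - y * s

perp : Vec2 → Vec2
perp (s , t) = t , - s

-- G v: the coordinates of v ∈ Γ ⊆ Γ* in the basis of Γ* dual to that of Γ.
dualCoords : Form → Vec2 → Vec2
dualCoords (form a b c) (x , y) = a * x + b * y , b * x + c * y

_∣ᵥ_ : ℤ → Vec2 → Set
k ∣ᵥ (x , y) = (k ∣ x) × (k ∣ y)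

∣-resp-≡ : ∀ {k m n} → k ∣ m → m ≡ n → k ∣ n
∣-resp-≡ {k} k∣m m≡n = subst (k ∣_) m≡n k∣m

+∣i∣≡ε*i : ∀ i → ∃ λ ε → + ∣ i ∣ ≡ ε * i
+∣i∣≡ε*i (+ n)    = 1ℤ , sym (*-identityˡ (+ n))
+∣i∣≡ε*i -[1+ n ] = -1ℤ , sym (-1*i≡-i -[1+ n ])

1+bn≡am⇒am-bn≡1 : ∀ a b m n → 1ℤ + b * n ≡ a * m → a * m + - b * n ≡ 1ℤ
1+bn≡am⇒am-bn≡1 a b m n e = subst (λ am → am + - b * n ≡ 1ℤ) e (cancel b n)
  where
  cancel : ∀ b n → 1ℤ + b * n + - b * n ≡ 1ℤ
  cancel = solve-∀

ℕ-Bézout⇒ℤ-Bézout : ∀ {m n} → ℕ.Bézout.Identity 1 m n → ∃₂ λ α β → α * + m + β * + n ≡ 1ℤ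
ℕ-Bézout⇒ℤ-Bézout {m} {n} (ℕ.Bézout.+- x y eq) =
  + x , - + y , 1+bn≡am⇒am-bn≡1 (+ x) (+ y) (+ m) (+ n)
    (trans (cong (_+_ 1ℤ) (sym (pos-* y n))) (trans (cong +_ eq) (pos-* x m)))
ℕ-Bézout⇒ℤ-Bézout {m} {n} (ℕ.Bézout.-+ x y eq) =
  - + x , + y , trans (+-comm (- + x * + m) (+ y * + n)) (1+bn≡am⇒am-bn≡1 (+ y) (+ x) (+ n) (+ m)
    (trans (cong (_+_ 1ℤ) (sym (pos-* x m))) (trans (cong +_ eq) (pos-* y n))))

gcd[i,j]≡1⇒Bézout : ∀ {i j} → gcd i j ≡ 1ℤ → ∃₂ λ α β → α * i + β * j ≡ 1ℤ
gcd[i,j]≡1⇒Bézout {i} {j} gcd≡1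
  with εi , ∣i∣≡εi*i ← +∣i∣≡ε*i i | εj , ∣j∣≡εj*j ← +∣i∣≡ε*i j
  with α , β , bézout ←
         ℕ-Bézout⇒ℤ-Bézout (ℕ.coprime-Bézout (ℕ.gcd≡1⇒coprime (+-injective gcd≡1))) =
  α * εi , β * εj , (begin
    α * εi * i + β * εj * j     ≡⟨ cong₂ _+_ (*-assoc α εi i) (*-assoc β εj j) ⟩
    α * (εi * i) + β * (εj * j) ≡⟨ cong₂ (λ u v → α * u + β * v) ∣i∣≡εi*i ∣j∣≡εj*j ⟨
    α * + ∣ i ∣ + β * + ∣ j ∣   ≡⟨ bézout ⟩
    1ℤ                          ∎)
  where open ≡-Reasoning

∣ᵥ-cancel : ∀ {k} n v → PrimitiveVec v → k ∣ᵥ n · v → k ∣ n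
∣ᵥ-cancel {k} n (s , t) prim (k∣ns , k∣nt) with α , β , bézout ← gcd[i,j]≡1⇒Bézout {s} {t} prim =
  ∣-resp-≡ (∣m∣n⇒∣m+n (∣n⇒∣m*n α k∣ns) (∣n⇒∣m*n β k∣nt)) (begin
    α * (n * s) + β * (n * t) ≡⟨ factor α β n s t ⟩
    n * (α * s + β * t)       ≡⟨ cong (n *_) bézout ⟩
    n * 1ℤ                    ≡⟨ *-identityʳ n ⟩
    n                         ∎)
  where
  open ≡-Reasoning
  factor : ∀ α β n s t → α * (n * s) + β * (n * t) ≡ n * (α * s + β * t)
  factor = solve-∀

PrimitiveVec-perp : ∀ v → PrimitiveVec v → PrimitiveVec (perp v)
PrimitiveVec-perp (s , t) prim =
  trans (cong (λ m → + ℕ.gcd ∣ t ∣ m) (∣-i∣≡∣i∣ s)) (trans (gcd-comm t s) prim)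

∙≡0⇒∈ℤperp : ∀ {p z} → PrimitiveVec z → p ∙ z ≡ 0ℤ → ∃ λ l → p ≡ l · perp z
∙≡0⇒∈ℤperp {p₁ , p₂} {s , t} prim p∙z≡0 with α , β , bézout ← gcd[i,j]≡1⇒Bézout {s} {t} prim =
  β * p₁ - α * p₂ ,
  cong₂ _,_ (sym (specialise p₁ α (first α β p₁ p₂ s t)))
            (sym (specialise p₂ β (second α β p₁ p₂ s t)))
  where
  open ≡-Reasoning
  first : ∀ α β p₁ p₂ s t →
          (β * p₁ - α * p₂) * t ≡ p₁ * (α * s + β * t) - α * (p₁ * s + p₂ * t)
  first = solve-∀
  second : ∀ α β p₁ p₂ s t →
           (β * p₁ - α * p₂) * - s ≡ p₂ * (α * s + β * t) - β * (p₁ * s + p₂ * t)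
  second = solve-∀
  x*1-c*0≡x : ∀ x c → x * 1ℤ - c * 0ℤ ≡ x
  x*1-c*0≡x = solve-∀
  specialise : ∀ {q} x c → q ≡ x * (α * s + β * t) - c * (p₁ * s + p₂ * t) → q ≡ x
  specialise {q} x c q≡ = begin
    q                                           ≡⟨ q≡ ⟩
    x * (α * s + β * t) - c * (p₁ * s + p₂ * t) ≡⟨ cong₂ (λ e o → x * e - c * o) bézout p∙z≡0 ⟩
    x * 1ℤ - c * 0ℤ                             ≡⟨ x*1-c*0≡x x c ⟩
    x                                           ∎

≡·⇒∣ᵥ : ∀ {p} k v → p ≡ k · v → k ∣ᵥ p
≡·⇒∣ᵥ k (x , y) refl = ∣m⇒∣m*n x ∣-refl , ∣m⇒∣m*n y ∣-refl

∣ᵥ-trans : ∀ {k m v} → k ∣ m → m ∣ᵥ v → k ∣ᵥ v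
∣ᵥ-trans k∣m (m∣x , m∣y) = ∣-trans k∣m m∣x , ∣-trans k∣m m∣y

∣ᵥ-⊖ʳ : ∀ {k p q} → k ∣ᵥ p → k ∣ᵥ p ⊖ q → k ∣ᵥ q
∣ᵥ-⊖ʳ {k} {p₁ , p₂} {q₁ , q₂} (k∣p₁ , k∣p₂) (k∣p₁-q₁ , k∣p₂-q₂) =
  ∣-resp-≡ (∣m∣n⇒∣m-n k∣p₁ k∣p₁-q₁) (p-[p-q]≡q p₁ q₁) ,
  ∣-resp-≡ (∣m∣n⇒∣m-n k∣p₂ k∣p₂-q₂) (p-[p-q]≡q p₂ q₂)
  where
  p-[p-q]≡q : ∀ p q → p - (p - q) ≡ q
  p-[p-q]≡q = solve-∀

∣ᵥ-transfer : ∀ {k m p q} → k ∣ m → m ∣ᵥ p ⊖ q → k ∣ᵥ p → k ∣ᵥ q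
∣ᵥ-transfer k∣m m∣ᵥp⊖q k∣ᵥp = ∣ᵥ-⊖ʳ k∣ᵥp (∣ᵥ-trans k∣m m∣ᵥp⊖q)

∣ᵥ-⊖-comm : ∀ {k p q} → k ∣ᵥ p ⊖ q → k ∣ᵥ q ⊖ p
∣ᵥ-⊖-comm {k} {p₁ , p₂} {q₁ , q₂} (k∣p₁-q₁ , k∣p₂-q₂) =
  ∣-resp-≡ (∣m⇒∣-m k∣p₁-q₁) (-[p-q]≡q-p p₁ q₁) , ∣-resp-≡ (∣m⇒∣-m k∣p₂-q₂) (-[p-q]≡q-p p₂ q₂)
  where
  -[p-q]≡q-p : ∀ p q → - (p - q) ≡ q - p
  -[p-q]≡q-p = solve-∀

∣ᵥ⇒*∣∙· : ∀ {l p} k u → l ∣ᵥ p → k * l ∣ p ∙ (k · u)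
∣ᵥ⇒*∣∙· {l} {p₁ , p₂} k (u₁ , u₂) (l∣p₁ , l∣p₂) =
  ∣-resp-≡ (*-monoʳ-∣ k (∣m∣n⇒∣m+n (∣m⇒∣m*n u₁ l∣p₁) (∣m⇒∣m*n u₂ l∣p₂))) (pull-out k p₁ p₂ u₁ u₂)
  where
  pull-out : ∀ k p₁ p₂ u₁ u₂ → k * (p₁ * u₁ + p₂ * u₂) ≡ p₁ * (k * u₁) + p₂ * (k * u₂)
  pull-out = solve-∀

B≡dualCoords∙ : ∀ G u v → B G u v ≡ dualCoords G u ∙ v
B≡dualCoords∙ (form a b c) (x , y) (x' , y') = regroup a b c x y x' y'
  where
  regroup : ∀ a b c x y x' y' → a * x * x' + b * (x * y' + y * x') + c * y * y'
                                ≡ (a * x + b * y) * x' + (b * x + c * y) * y'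
  regroup = solve-∀

B≡l*det : ∀ G w z l → dualCoords G w ≡ l · perp z → B G w w ≡ l * det w z
B≡l*det G w@(x , y) (s , t) l Gw≡l·z⊥ = begin
  B G w w                     ≡⟨ B≡dualCoords∙ G w w ⟩
  dualCoords G w ∙ w          ≡⟨ cong (_∙ w) Gw≡l·z⊥ ⟩
  l * t * x + l * - s * y     ≡⟨ factor l s t x y ⟩
  l * (x * t - y * s)         ∎
  where
  open ≡-Reasoning
  factor : ∀ l s t x y → l * t * x + l * - s * y ≡ l * (x * t - y * s)
  factor = solve-∀

B-difference : ∀ G w w' →
  B G w w - B G w' w' ≡ dualCoords G w ∙ (w ⊖ w') + dualCoords G w' ∙ (w ⊖ w')
B-difference (form a b c) (x , y) (x' , y') = expand a b c x y x' y'
  where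
  expand : ∀ a b c x y x' y' →
    (a * x * x + b * (x * y + y * x) + c * y * y) - (a * x' * x' + b * (x' * y' + y' * x') + c * y' * y')
    ≡ (a * x + b * y) * (x - x') + (b * x + c * y) * (y - y')
      + ((a * x' + b * y') * (x - x') + (b * x' + c * y') * (y - y'))
  expand = solve-∀

B-difference-∣ : ∀ G w w' u k {l} → w ⊖ w' ≡ k · u →
  l ∣ᵥ dualCoords G w → l ∣ᵥ dualCoords G w' → k * l ∣ B G w w - B G w' w'
B-difference-∣ G w w' u k w⊖w'≡k·u l∣ᵥGw l∣ᵥGw' =
  ∣-resp-≡ (∣m∣n⇒∣m+n (∣ᵥ⇒*∣∙· k u l∣ᵥGw) (∣ᵥ⇒*∣∙· k u l∣ᵥGw')) (sym (begin
    B G w w - B G w' w'                                     ≡⟨ B-difference G w w' ⟩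
    dualCoords G w ∙ (w ⊖ w') + dualCoords G w' ∙ (w ⊖ w') ≡⟨ cong (λ v → dualCoords G w ∙ v + dualCoords G w' ∙ v) w⊖w'≡k·u ⟩
    dualCoords G w ∙ (k · u) + dualCoords G w' ∙ (k · u)   ∎))
  where open ≡-Reasoning

∣ᵥdualCoords⇒∣disc : ∀ {k} G v → PrimitiveVec v → k ∣ᵥ dualCoords G v → k ∣ disc G
∣ᵥdualCoords⇒∣disc (form a b c) (x , y) prim (k∣p₁ , k∣p₂) = ∣ᵥ-cancel (a * c - b * b) (x , y) prim
  ( ∣-resp-≡ (∣m∣n⇒∣m-n (∣n⇒∣m*n c k∣p₁) (∣n⇒∣m*n b k∣p₂)) (adjugate₁ a b c x y)
  , ∣-resp-≡ (∣m∣n⇒∣m-n (∣n⇒∣m*n a k∣p₂) (∣n⇒∣m*n b k∣p₁)) (adjugate₂ a b c x y))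
  where
  adjugate₁ : ∀ a b c x y → c * (a * x + b * y) - b * (b * x + c * y) ≡ (a * c - b * b) * x
  adjugate₁ = solve-∀
  adjugate₂ : ∀ a b c x y → a * (b * x + c * y) - b * (a * x + b * y) ≡ (a * c - b * b) * y
  adjugate₂ = solve-∀

CongModDDual⇒∣ᵥ : ∀ G w w' → CongModDDual G w w' → disc G ∣ᵥ dualCoords G w ⊖ dualCoords G w'
CongModDDual⇒∣ᵥ (form a b c) (x , y) (x' , y') d∣ =
  ∣-resp-≡ (∣ᵤ⇒∣ (d∣ (1ℤ , 0ℤ))) (at-e₁ a b c x y x' y') ,
  ∣-resp-≡ (∣ᵤ⇒∣ (d∣ (0ℤ , 1ℤ))) (at-e₂ a b c x y x' y')
  where
  at-e₁ : ∀ a b c x y x' y' →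
    a * 1ℤ * (x - x') + b * (1ℤ * (y - y') + 0ℤ * (x - x')) + c * 0ℤ * (y - y')
    ≡ (a * x + b * y) - (a * x' + b * y')
  at-e₁ = solve-∀
  at-e₂ : ∀ a b c x y x' y' →
    a * 0ℤ * (x - x') + b * (0ℤ * (y - y') + 1ℤ * (x - x')) + c * 1ℤ * (y - y')
    ≡ (b * x + c * y) - (b * x' + c * y')
  at-e₂ = solve-∀

¬2∣⇒%2≡1 : ∀ n → ¬ 2 ℕ.∣ n → n % 2 ≡ 1
¬2∣⇒%2≡1 n 2∤n with n % 2 in eq | ℕ.m%n<n n 2
... | 0                 | _                   = contradiction (ℕ.m%n≡0⇒n∣m n 2 eq) 2∤n
... | 1                 | _                   = refl
... | ℕ.suc (ℕ.suc _)   | ℕ.s≤s (ℕ.s≤s ())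

%2-cong : ∀ m n → (2 ℕ.∣ m → 2 ℕ.∣ n) → (2 ℕ.∣ n → 2 ℕ.∣ m) → m % 2 ≡ n % 2
%2-cong m n m⇒n n⇒m with 2 ℕ.∣? m
... | yes 2∣m = trans (ℕ.n∣m⇒m%n≡0 m 2 2∣m) (sym (ℕ.n∣m⇒m%n≡0 n 2 (m⇒n 2∣m)))
... | no 2∤m  = trans (¬2∣⇒%2≡1 m 2∤m) (sym (¬2∣⇒%2≡1 n (2∤m ∘ n⇒m)))

∣∣%2-cong : ∀ i j → + 2 ∣ i - j → ∣ i ∣ % 2 ≡ ∣ j ∣ % 2
∣∣%2-cong i j 2∣i-j = %2-cong ∣ i ∣ ∣ j ∣
  (λ 2∣i → ∣⇒∣ᵤ (∣-resp-≡ (∣m∣n⇒∣m-n (∣ᵤ⇒∣ {i = i} 2∣i) 2∣i-j) (i-[i-j]≡j i j)))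
  (λ 2∣j → ∣⇒∣ᵤ (∣-resp-≡ (∣m∣n⇒∣m+n 2∣i-j (∣ᵤ⇒∣ {i = j} 2∣j)) (i-j+j≡i i j)))
  where
  i-[i-j]≡j : ∀ i j → i - (i - j) ≡ j
  i-[i-j]≡j = solve-∀
  i-j+j≡i : ∀ i j → i - j + j ≡ i
  i-j+j≡i = solve-∀

∣i∣≡∣j∣⇒j≡i⊎j≡-i : ∀ i j → ∣ i ∣ ≡ ∣ j ∣ → j ≡ i ⊎ j ≡ - i
∣i∣≡∣j∣⇒j≡i⊎j≡-i (+ m)    (+ n)    refl = inj₁ refl
∣i∣≡∣j∣⇒j≡i⊎j≡-i (+ m)    -[1+ n ] refl = inj₂ refl
∣i∣≡∣j∣⇒j≡i⊎j≡-i -[1+ m ] (+ n)    refl = inj₂ refl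
∣i∣≡∣j∣⇒j≡i⊎j≡-i -[1+ m ] -[1+ n ] refl = inj₁ refl

2l∣lE⇒2∣E : ∀ {l E} → l ≢ 0ℤ → + 2 * l ∣ l * E → + 2 ∣ E
2l∣lE⇒2∣E {l} {E} l≢0 2l∣lE =
  *-cancelˡ-∣ l {{≢-nonZero l≢0}} (subst (_∣ l * E) (*-comm (+ 2) l) 2l∣lE)

∣∣%2-cancel : ∀ l l' D D' → l ≢ 0ℤ → ∣ l ∣ ≡ ∣ l' ∣ →
              + 2 * l ∣ l * D - l' * D' → ∣ D ∣ % 2 ≡ ∣ D' ∣ % 2
∣∣%2-cancel l l' D D' l≢0 ∣l∣≡∣l'∣ 2l∣ with ∣i∣≡∣j∣⇒j≡i⊎j≡-i l l' ∣l∣≡∣l'∣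
... | inj₁ refl = ∣∣%2-cong D D' (2l∣lE⇒2∣E l≢0 (∣-resp-≡ 2l∣ (factor l D D')))
  where
  factor : ∀ l D D' → l * D - l * D' ≡ l * (D - D')
  factor = solve-∀
... | inj₂ refl =
  trans (∣∣%2-cong D (- D') (2l∣lE⇒2∣E l≢0 (∣-resp-≡ 2l∣ (factor l D D')))) (cong (_% 2) (∣-i∣≡∣i∣ D'))
  where
  factor : ∀ l D D' → l * D - - l * D' ≡ l * (D - - D')
  factor = solve-∀

Orth⇒dualCoords≡·perp : ∀ G w z → PrimitiveVec z → Orth G w z →
                        ∃ λ l → dualCoords G w ≡ l · perp z
Orth⇒dualCoords≡·perp G w z z-prim w⊥z =
  ∙≡0⇒∈ℤperp {dualCoords G w} {z} z-prim (trans (sym (B≡dualCoords∙ G w z)) w⊥z)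

coefficient∣disc : ∀ G w v l → PrimitiveVec w → dualCoords G w ≡ l · v → l ∣ disc G
coefficient∣disc G w v l w-prim Gw≡l·v = ∣ᵥdualCoords⇒∣disc G w w-prim (≡·⇒∣ᵥ l v Gw≡l·v)

coefficient-∣ : ∀ G w w' z z' l l' → PrimitiveVec w → PrimitiveVec z' →
                disc G ∣ᵥ dualCoords G w ⊖ dualCoords G w' →
                dualCoords G w ≡ l · perp z → dualCoords G w' ≡ l' · perp z' → l ∣ l'
coefficient-∣ G w w' z z' l l' w-prim z'-prim d∣ᵥGw⊖Gw' Gw≡l·z⊥ Gw'≡l'·z'⊥ =
  ∣ᵥ-cancel l' (perp z') (PrimitiveVec-perp z' z'-prim) (subst (l ∣ᵥ_) Gw'≡l'·z'⊥
    (∣ᵥ-transfer (coefficient∣disc G w (perp z) l w-prim Gw≡l·z⊥) d∣ᵥGw⊖Gw' (≡·⇒∣ᵥ l (perp z) Gw≡l·z⊥)))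

propositionC3 : (G : Form) → PosDef G → PrimitiveForm G →
    (w w' z z' : Vec2) →
    PrimitiveVec w → PrimitiveVec w' →
    CongModDDual G w w' → CongMod2Γ w w' →
    PrimitiveVec z → Orth G w z →
    PrimitiveVec z' → Orth G w' z' →
    index w z % 2 ≡ index w' z' % 2
propositionC3 G (_ , 0<d) _ w w' z z' w-prim w'-prim w≡w'[dΓ*] (u , w⊖w'≡2u) z-prim w⊥z z'-prim w'⊥z' =
  parity (Orth⇒dualCoords≡·perp G w z z-prim w⊥z) (Orth⇒dualCoords≡·perp G w' z' z'-prim w'⊥z')
  where
  d∣ᵥGw⊖Gw' : disc G ∣ᵥ dualCoords G w ⊖ dualCoords G w'
  d∣ᵥGw⊖Gw' = CongModDDual⇒∣ᵥ G w w' w≡w'[dΓ*]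
  parity : (∃ λ l → dualCoords G w ≡ l · perp z) → (∃ λ l' → dualCoords G w' ≡ l' · perp z') →
           ∣ det w z ∣ % 2 ≡ ∣ det w' z' ∣ % 2
  parity (l , Gw≡l·z⊥) (l' , Gw'≡l'·z'⊥) =
    ∣∣%2-cancel l l' (det w z) (det w' z') l≢0 (ℕ.∣-antisym (∣⇒∣ᵤ l∣l') (∣⇒∣ᵤ l'∣l)) 2l∣lD-l'D'
    where
    l∣l' : l ∣ l'
    l∣l' = coefficient-∣ G w w' z z' l l' w-prim z'-prim d∣ᵥGw⊖Gw' Gw≡l·z⊥ Gw'≡l'·z'⊥
    l'∣l : l' ∣ l
    l'∣l = coefficient-∣ G w' w z' z l' l w'-prim z-prim
      (∣ᵥ-⊖-comm {p = dualCoords G w} {dualCoords G w'} d∣ᵥGw⊖Gw') Gw'≡l'·z'⊥ Gw≡l·z⊥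
    l≢0 : l ≢ 0ℤ
    l≢0 l≡0 = <-irrefl (sym (0∣⇒≡0 (subst (_∣ disc G) l≡0 l∣d))) 0<d
      where
      l∣d : l ∣ disc G
      l∣d = coefficient∣disc G w (perp z) l w-prim Gw≡l·z⊥
    2l∣lD-l'D' : + 2 * l ∣ l * det w z - l' * det w' z'
    2l∣lD-l'D' = subst (+ 2 * l ∣_)
      (cong₂ _-_ (B≡l*det G w z l Gw≡l·z⊥) (B≡l*det G w' z' l' Gw'≡l'·z'⊥))
      (B-difference-∣ G w w' u (+ 2) w⊖w'≡2u (≡·⇒∣ᵥ l (perp z) Gw≡l·z⊥)
        (∣ᵥ-trans l∣l' (≡·⇒∣ᵥ l' (perp z') Gw'≡l'·z'⊥)))
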